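{- Let $m$ and $n$ be positive integers. Then (i) $\mathcal{R}(K_{1,n})\cong K_2$; and (ii) if $m,n\geq 2$, then $\mathcal{R}(K_{m,n})\cong K_{2,mn}$.
   Context: All graphs are finite, simple and undirected; $N(v)$ denotes the open neighbourhood of $v$. A set $S\subseteq V(G)$ is a dominating set if every vertex of $G$ is in $S$ or adjacent to a vertex of $S$; it is a minimal dominating set if no proper subset of $S$ is a dominating set. The reconfiguration graph $\mathcal{R}(G)$ has as vertex set the collection of all minimal dominating sets of $G$, and two minimal dominating sets $M_1,M_2$ are adjacent iff there is a vertex $v$ with either ($M_2\setminus M_1=\{v\}$ and $M_1\setminus M_2\subseteq N(v)$) or ($M_1\setminus M_2=\{v\}$ and $M_2\setminus M_1\subseteq N(v)$). -}

module Defs where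

open import Data.Nat using (ℕ; _<_; _≤_; _+_; _*_)
open import Data.Fin using (Fin; toℕ)
open import Data.Fin.Subset using (Subset; _∈_; _∉_; _⊂_)
open import Data.Product using (Σ; ∃; _×_; _,_)
open import Data.Sum using (_⊎_; inj₁; inj₂)
open import Data.Nat.Properties using (<⇒≱)
open import Relation.Nullary using (¬_)
open import Relation.Binary.PropositionalEquality using (_≡_; _≢_) renaming (sym to ≡-sym)
open import Function.Bundles using (_⇔_)

record Graph (n : ℕ) : Set₁ where
  field
    Adj   : Fin n → Fin n → Set
    irrefl : ∀ v → ¬ Adj v v
    sym   : ∀ {u v} → Adj u v → Adj v u
open Graph public

K : (n : ℕ) → Graph n
K n = record { Adj = λ u v → u ≢ v ; irrefl = λ v p → p _≡_.refl ; sym = λ p q → p (≡-sym q) }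

-- Complete bipartite graph K_{m,n} on Fin (m + n):
-- vertices with index < m form one part, the others form the second part.
KBAdj : (m n : ℕ) → Fin (m + n) → Fin (m + n) → Set
KBAdj m n u v = (toℕ u < m × m ≤ toℕ v) ⊎ (m ≤ toℕ u × toℕ v < m)


KB : (m n : ℕ) → Graph (m + n)
KB m n = record
  { Adj = KBAdj m n
  ; irrefl = λ { v (inj₁ (a , b)) → <⇒≱ a b ; v (inj₂ (a , b)) → <⇒≱ b a }
  ; sym = λ { (inj₁ (a , b)) → inj₂ (b , a) ; (inj₂ (a , b)) → inj₁ (b , a) }
  }

module _ {N : ℕ} (G : Graph N) where

  Dominating : Subset N → Set
  Dominating S = ∀ v → v ∈ S ⊎ ∃ (λ u → u ∈ S × Adj G u v)

  MinDom : Subset N → Set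
  MinDom S = Dominating S × (∀ T → T ⊂ S → ¬ Dominating T)

  Step : Subset N → Subset N → Fin N → Set
  Step M₁ M₂ v = (∀ x → (x ∈ M₂ × x ∉ M₁) ⇔ (x ≡ v))
               × (∀ x → x ∈ M₁ → x ∉ M₂ → Adj G v x)

  RAdj : Subset N → Subset N → Set
  RAdj M₁ M₂ = ∃ (λ v → Step M₁ M₂ v ⊎ Step M₂ M₁ v)

  -- R(G) ≅ H: an enumeration f of the minimal dominating sets of G indexed
  -- by the vertices of H, which is a bijection onto the set of minimal
  -- dominating sets and carries adjacency of H exactly to adjacency in R(G).
  ReconfIso : {k : ℕ} → Graph k → Set
  ReconfIso {k} H = Σ (Fin k → Subset N) λ f →
      (∀ i → MinDom (f i))
    × (∀ S → MinDom S → ∃ (λ i → f i ≡ S))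
    × (∀ i j → f i ≡ f j → i ≡ j)
    × (∀ i j → Adj H i j ⇔ RAdj (f i) (f j))

module Submission where

-- A set S dominates the vertices of the side A of K_{m,n} iff A ⊆ S or S meets B, and
-- symmetrically for B. Hence a minimal dominating set is A, B, or an edge {a, b}; an edge is
-- minimal iff both sides have at least two vertices, for if A = {a} then A ⊂ {a, b}.
-- A reconfiguration step brings in exactly one vertex v and may drop only neighbours of v:
-- A (resp. B) reaches every edge {a, b} by bringing in b (resp. a), which is adjacent to all of A
-- (resp. B). For m, n ≥ 2 there are no other steps: going between A and B would bring in at
-- least two vertices, and going between two edges would drop a vertex lying on the same side
-- as the vertex brought in. For m = 1, R(K_{1,n}) consists of A = {a} and B, joined by adding a.

open import Defs hiding (sym)
open import Data.Nat using (ℕ; suc; _+_; _*_; _≤_; _<_; _<?_; _≤?_; s≤s)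
open import Data.Nat.Properties using (<⇒≱; ≮⇒≥; m≤m+n)
open import Data.Bool.Properties using (T-≡)
open import Data.Product using (_×_; _,_; proj₁; proj₂; Σ; ∃; ∃₂; uncurry)
open import Data.Product.Properties using (×-≡,≡→≡)
open import Data.Sum using (_⊎_; inj₁; inj₂)
open import Data.Fin as Fin using (Fin; toℕ; _↑ˡ_; _↑ʳ_; splitAt; remQuot; combine)
open import Data.Fin.Patterns using (0F; 1F)
open import Data.Fin.Properties using (toℕ-↑ˡ; toℕ-↑ʳ; toℕ<n; ↑ˡ-injective; ↑ʳ-injective;
  splitAt⁻¹-↑ˡ; splitAt⁻¹-↑ʳ; any?; remQuot-combine; *↔×)
open import Data.Fin.Subset using (Subset; _∈_; _∉_; _⊆_; _⊂_; ⁅_⁆; _∪_)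
open import Data.Fin.Subset.Properties using (_∈?_; ⊆-antisym; x∈p∪q⁻; x∈p∪q⁺; x∈⁅x⁆; x∈⁅y⁆⇒x≡y)
open import Data.Vec using (tabulate)
open import Data.Vec.Properties using (lookup∘tabulate; []=⇒lookup; lookup⇒[]=)
open import Level using (0ℓ)
open import Relation.Nullary using (yes; no; ¬_; contradiction)
open import Relation.Nullary.Decidable using (isYes; toWitness; fromWitness)
open import Relation.Unary using (Pred; Decidable)
open import Relation.Binary.PropositionalEquality
  using (_≡_; _≢_; refl; sym; trans; cong; subst)
open import Function using (_∘_)
open import Function.Bundles using (_⇔_; mk⇔; Equivalence; Injection)
open import Function.Properties.Inverse using (↔⇒↣)

module _ {n p} {P : Pred (Fin n) p} (P? : Decidable P) where

  subset : Subset n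
  subset = tabulate (isYes ∘ P?)

  ∈-subset⁻ : ∀ {x} → x ∈ subset → P x
  ∈-subset⁻ {x} x∈ = toWitness {a? = P? x}
    (Equivalence.from T-≡ (trans (sym (lookup∘tabulate _ x)) ([]=⇒lookup x∈)))

  ∈-subset⁺ : ∀ {x} → P x → x ∈ subset
  ∈-subset⁺ {x} px = lookup⇒[]= x _
    (trans (lookup∘tabulate _ x) (Equivalence.to T-≡ (fromWitness {a? = P? x} px)))

both⇔ : ∀ {a b} {P : Set a} {Q : Set b} → P → Q → P ⇔ Q
both⇔ p q = mk⇔ (λ _ → q) (λ _ → p)

neither⇔ : ∀ {a b} {P : Set a} {Q : Set b} → ¬ P → ¬ Q → P ⇔ Q
neither⇔ ¬p ¬q = mk⇔ (λ p → contradiction p ¬p) (λ q → contradiction q ¬q)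

two-distinct : ∀ {m} → 2 ≤ m → Σ (Fin m × Fin m) λ (i , j) → i ≢ j
two-distinct (s≤s (s≤s _)) = (0F , 1F) , λ ()

module _ {N} (G : Graph N) where

  MinDom-⊇⇒≡ : ∀ {S T} → MinDom G S → Dominating G T → T ⊆ S → S ≡ T
  MinDom-⊇⇒≡ {S} {T} (_ , minimal) T-dom T⊆S = ⊆-antisym S⊆T T⊆S
    where
    S⊆T : S ⊆ T
    S⊆T {x} x∈S with x ∈? T
    ... | yes x∈T = x∈T
    ... | no  x∉T = contradiction T-dom (minimal T (T⊆S , x , x∈S , x∉T))

  Step-new : ∀ {M₁ M₂ v} → Step G M₁ M₂ v → v ∈ M₂ × v ∉ M₁
  Step-new {v = v} (new , _) = Equivalence.from (new v) refl

  Step-new⇒≡ : ∀ {M₁ M₂ v x} → Step G M₁ M₂ v → x ∈ M₂ → x ∉ M₁ → x ≡ v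
  Step-new⇒≡ {x = x} (new , _) x∈M₂ x∉M₁ = Equivalence.to (new x) (x∈M₂ , x∉M₁)

  RAdj-irrefl : ∀ {M} → ¬ RAdj G M M
  RAdj-irrefl (_ , inj₁ step) = proj₂ (Step-new step) (proj₁ (Step-new step))
  RAdj-irrefl (_ , inj₂ step) = proj₂ (Step-new step) (proj₁ (Step-new step))

  RAdj-sym : ∀ {M₁ M₂} → RAdj G M₁ M₂ → RAdj G M₂ M₁
  RAdj-sym (v , inj₁ step) = v , inj₂ step
  RAdj-sym (v , inj₂ step) = v , inj₁ step

module CompleteBipartite (m n : ℕ) where

  G : Graph (m + n)
  G = KB m n

  IsA IsB : Pred (Fin (m + n)) 0ℓ
  IsA x = toℕ x < m
  IsB x = m ≤ toℕ x

  IsA? : Decidable IsA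
  IsA? x = toℕ x <? m

  IsB? : Decidable IsB
  IsB? x = m ≤? toℕ x

  A B : Subset (m + n)
  A = subset IsA?
  B = subset IsB?

  IsA⇒¬IsB : ∀ {x} → IsA x → ¬ IsB x
  IsA⇒¬IsB = <⇒≱

  IsA⊎IsB : ∀ x → IsA x ⊎ IsB x
  IsA⊎IsB x with IsA? x
  ... | yes ax = inj₁ ax
  ... | no ¬ax = inj₂ (≮⇒≥ ¬ax)

  ∈A⁺ : ∀ {x} → IsA x → x ∈ A
  ∈A⁺ = ∈-subset⁺ IsA?

  ∈A⁻ : ∀ {x} → x ∈ A → IsA x
  ∈A⁻ = ∈-subset⁻ IsA?

  ∈B⁺ : ∀ {x} → IsB x → x ∈ B
  ∈B⁺ = ∈-subset⁺ IsB?

  ∈B⁻ : ∀ {x} → x ∈ B → IsB x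
  ∈B⁻ = ∈-subset⁻ IsB?

  IsA⇒∉B : ∀ {x} → IsA x → x ∉ B
  IsA⇒∉B ax x∈B = IsA⇒¬IsB ax (∈B⁻ x∈B)

  IsB⇒∉A : ∀ {x} → IsB x → x ∉ A
  IsB⇒∉A bx x∈A = IsA⇒¬IsB (∈A⁻ x∈A) bx

  ∉A⇒IsB : ∀ {x} → x ∉ A → IsB x
  ∉A⇒IsB {x} x∉A with IsA⊎IsB x
  ... | inj₁ ax = contradiction (∈A⁺ ax) x∉A
  ... | inj₂ bx = bx

  ∉B⇒IsA : ∀ {x} → x ∉ B → IsA x
  ∉B⇒IsA {x} x∉B with IsA⊎IsB x
  ... | inj₁ ax = ax
  ... | inj₂ bx = contradiction (∈B⁺ bx) x∉B

  IsA-↑ˡ : ∀ q → IsA (q ↑ˡ n)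
  IsA-↑ˡ q = subst (_< m) (sym (toℕ-↑ˡ q n)) (toℕ<n q)

  IsB-↑ʳ : ∀ r → IsB (m ↑ʳ r)
  IsB-↑ʳ r = subst (m ≤_) (sym (toℕ-↑ʳ m r)) (m≤m+n m (toℕ r))

  IsA⇒↑ˡ : ∀ {x} → IsA x → ∃ λ q → q ↑ˡ n ≡ x
  IsA⇒↑ˡ {x} ax with splitAt m x in eq
  ... | inj₁ q = q , splitAt⁻¹-↑ˡ eq
  ... | inj₂ r = contradiction (subst IsB (splitAt⁻¹-↑ʳ eq) (IsB-↑ʳ r)) (IsA⇒¬IsB ax)

  IsB⇒↑ʳ : ∀ {x} → IsB x → ∃ λ r → m ↑ʳ r ≡ x
  IsB⇒↑ʳ {x} bx with splitAt m x in eq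
  ... | inj₁ q = contradiction bx (IsA⇒¬IsB (subst IsA (splitAt⁻¹-↑ˡ eq) (IsA-↑ˡ q)))
  ... | inj₂ r = r , splitAt⁻¹-↑ʳ eq

  Adj-A-A : ∀ {u v} → IsA u → IsA v → ¬ Adj G u v
  Adj-A-A _  av (inj₁ (_ , bv)) = IsA⇒¬IsB av bv
  Adj-A-A au _  (inj₂ (bu , _)) = IsA⇒¬IsB au bu

  Adj-B-B : ∀ {u v} → IsB u → IsB v → ¬ Adj G u v
  Adj-B-B bu _  (inj₁ (au , _)) = IsA⇒¬IsB au bu
  Adj-B-B _  bv (inj₂ (_ , av)) = IsA⇒¬IsB av bv

  MeetsA MeetsB : Subset (m + n) → Set
  MeetsA S = ∃ λ q → q ↑ˡ n ∈ S
  MeetsB S = ∃ λ r → m ↑ʳ r ∈ S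

  Dominating⇒ : ∀ {S} → Dominating G S → (A ⊆ S ⊎ MeetsB S) × (B ⊆ S ⊎ MeetsA S)
  Dominating⇒ {S} S-dom = dominatesA , dominatesB
    where
    dominatesA : A ⊆ S ⊎ MeetsB S
    dominatesA with any? (λ r → m ↑ʳ r ∈? S)
    ... | yes meets = inj₂ meets
    ... | no ¬meets = inj₁ (λ x∈A → covers (∈A⁻ x∈A))
      where
      covers : ∀ {x} → IsA x → x ∈ S
      covers {x} ax with S-dom x
      ... | inj₁ x∈S = x∈S
      ... | inj₂ (_ , _ , inj₁ (_ , bx)) = contradiction bx (IsA⇒¬IsB ax)
      ... | inj₂ (u , u∈S , inj₂ (bu , _)) with IsB⇒↑ʳ bu
      ...   | r , refl = contradiction (r , u∈S) ¬meets
    dominatesB : B ⊆ S ⊎ MeetsA S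
    dominatesB with any? (λ q → q ↑ˡ n ∈? S)
    ... | yes meets = inj₂ meets
    ... | no ¬meets = inj₁ (λ x∈B → covers (∈B⁻ x∈B))
      where
      covers : ∀ {x} → IsB x → x ∈ S
      covers {x} bx with S-dom x
      ... | inj₁ x∈S = x∈S
      ... | inj₂ (_ , _ , inj₂ (_ , ax)) = contradiction bx (IsA⇒¬IsB ax)
      ... | inj₂ (u , u∈S , inj₁ (au , _)) with IsA⇒↑ˡ au
      ...   | q , refl = contradiction (q , u∈S) ¬meets

  ⇒Dominating : ∀ {S} → A ⊆ S ⊎ MeetsB S → B ⊆ S ⊎ MeetsA S → Dominating G S
  ⇒Dominating dominatesA dominatesB v with IsA⊎IsB v | dominatesA | dominatesB
  ... | inj₁ av | inj₁ A⊆S      | _ = inj₁ (A⊆S (∈A⁺ av))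
  ... | inj₁ av | inj₂ (r , r∈S) | _ = inj₂ (m ↑ʳ r , r∈S , inj₂ (IsB-↑ʳ r , av))
  ... | inj₂ bv | _ | inj₁ B⊆S      = inj₁ (B⊆S (∈B⁺ bv))
  ... | inj₂ bv | _ | inj₂ (q , q∈S) = inj₂ (q ↑ˡ n , q∈S , inj₁ (IsA-↑ˡ q , bv))

  pair : Fin m → Fin n → Subset (m + n)
  pair q r = ⁅ q ↑ˡ n ⁆ ∪ ⁅ m ↑ʳ r ⁆

  ∈-pairˡ : ∀ {q r} → q ↑ˡ n ∈ pair q r
  ∈-pairˡ = x∈p∪q⁺ (inj₁ (x∈⁅x⁆ _))

  ∈-pairʳ : ∀ {q r} → m ↑ʳ r ∈ pair q r
  ∈-pairʳ = x∈p∪q⁺ (inj₂ (x∈⁅x⁆ _))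

  ∈-pair⁻ : ∀ {q r x} → x ∈ pair q r → x ≡ q ↑ˡ n ⊎ x ≡ m ↑ʳ r
  ∈-pair⁻ {q} {r} x∈ with x∈p∪q⁻ ⁅ q ↑ˡ n ⁆ ⁅ m ↑ʳ r ⁆ x∈
  ... | inj₁ x∈ˡ = inj₁ (x∈⁅y⁆⇒x≡y _ x∈ˡ)
  ... | inj₂ x∈ʳ = inj₂ (x∈⁅y⁆⇒x≡y _ x∈ʳ)

  ∈-pair-A : ∀ {q r x} → IsA x → x ∈ pair q r → x ≡ q ↑ˡ n
  ∈-pair-A ax x∈ with ∈-pair⁻ x∈
  ... | inj₁ x≡ = x≡
  ... | inj₂ refl = contradiction (IsB-↑ʳ _) (IsA⇒¬IsB ax)

  ∈-pair-B : ∀ {q r x} → IsB x → x ∈ pair q r → x ≡ m ↑ʳ r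
  ∈-pair-B bx x∈ with ∈-pair⁻ x∈
  ... | inj₂ x≡ = x≡
  ... | inj₁ refl = contradiction bx (IsA⇒¬IsB (IsA-↑ˡ _))

  ↑ˡ∈pair⇒≡ : ∀ {q q' r} → q' ↑ˡ n ∈ pair q r → q' ≡ q
  ↑ˡ∈pair⇒≡ x∈ = ↑ˡ-injective n _ _ (∈-pair-A (IsA-↑ˡ _) x∈)

  ↑ʳ∈pair⇒≡ : ∀ {q r r'} → m ↑ʳ r' ∈ pair q r → r' ≡ r
  ↑ʳ∈pair⇒≡ x∈ = ↑ʳ-injective m _ _ (∈-pair-B (IsB-↑ʳ _) x∈)

  pair-injective : ∀ {q q' r r'} → pair q r ≡ pair q' r' → q ≡ q' × r ≡ r'
  pair-injective eq = ↑ˡ∈pair⇒≡ (subst (_ ∈_) eq ∈-pairˡ) , ↑ʳ∈pair⇒≡ (subst (_ ∈_) eq ∈-pairʳ)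

  A-dominating : Fin m → Dominating G A
  A-dominating q = ⇒Dominating (inj₁ (λ x∈A → x∈A)) (inj₂ (q , ∈A⁺ (IsA-↑ˡ q)))

  B-dominating : Fin n → Dominating G B
  B-dominating r = ⇒Dominating (inj₂ (r , ∈B⁺ (IsB-↑ʳ r))) (inj₁ (λ x∈B → x∈B))

  pair-dominating : ∀ q r → Dominating G (pair q r)
  pair-dominating q r = ⇒Dominating (inj₂ (r , ∈-pairʳ)) (inj₂ (q , ∈-pairˡ))

  A-MinDom : Fin m → MinDom G A
  A-MinDom q = A-dominating q , λ T T⊂A T-dom → excluded T⊂A (proj₁ (Dominating⇒ T-dom))
    where
    excluded : ∀ {T} → T ⊂ A → ¬ (A ⊆ T ⊎ MeetsB T)
    excluded (_ , x , x∈A , x∉T) (inj₁ A⊆T) = x∉T (A⊆T x∈A)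
    excluded (T⊆A , _) (inj₂ (r , r∈T)) = IsB⇒∉A (IsB-↑ʳ r) (T⊆A r∈T)

  B-MinDom : Fin n → MinDom G B
  B-MinDom r = B-dominating r , λ T T⊂B T-dom → excluded T⊂B (proj₂ (Dominating⇒ T-dom))
    where
    excluded : ∀ {T} → T ⊂ B → ¬ (B ⊆ T ⊎ MeetsA T)
    excluded (_ , x , x∈B , x∉T) (inj₁ B⊆T) = x∉T (B⊆T x∈B)
    excluded (T⊆B , _) (inj₂ (q , q∈T)) = IsA⇒∉B (IsA-↑ˡ q) (T⊆B q∈T)

  pair-MinDom : 2 ≤ m → 2 ≤ n → ∀ q r → MinDom G (pair q r)
  pair-MinDom 2≤m 2≤n q r =
    pair-dominating q r , λ T T⊂pair T-dom → excluded T⊂pair (Dominating⇒ T-dom)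
    where
    excluded : ∀ {T} → T ⊂ pair q r → ¬ ((A ⊆ T ⊎ MeetsB T) × (B ⊆ T ⊎ MeetsA T))
    excluded (T⊆pair , _) (inj₁ A⊆T , _) with two-distinct 2≤m
    ... | (q₀ , q₁) , q₀≢q₁ = q₀≢q₁ (trans (≡q q₀) (sym (≡q q₁)))
      where
      ≡q : ∀ q' → q' ≡ q
      ≡q q' = ↑ˡ∈pair⇒≡ (T⊆pair (A⊆T (∈A⁺ (IsA-↑ˡ q'))))
    excluded (T⊆pair , _) (inj₂ _ , inj₁ B⊆T) with two-distinct 2≤n
    ... | (r₀ , r₁) , r₀≢r₁ = r₀≢r₁ (trans (≡r r₀) (sym (≡r r₁)))
      where
      ≡r : ∀ r' → r' ≡ r
      ≡r r' = ↑ʳ∈pair⇒≡ (T⊆pair (B⊆T (∈B⁺ (IsB-↑ʳ r'))))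
    excluded {T} (T⊆pair , x , x∈pair , x∉T) (inj₂ (r' , r'∈T) , inj₂ (q' , q'∈T))
      with ∈-pair⁻ x∈pair
    ... | inj₁ refl = x∉T (subst (λ q → q ↑ˡ n ∈ T) (↑ˡ∈pair⇒≡ (T⊆pair q'∈T)) q'∈T)
    ... | inj₂ refl = x∉T (subst (λ r → m ↑ʳ r ∈ T) (↑ʳ∈pair⇒≡ (T⊆pair r'∈T)) r'∈T)

  MinDom-cases : Fin m → ∀ {S} → MinDom G S → S ≡ A ⊎ S ≡ B ⊎ ∃₂ λ q r → S ≡ pair q r
  MinDom-cases q₀ {S} S-min with Dominating⇒ (proj₁ S-min)
  ... | inj₁ A⊆S , _ = inj₁ (MinDom-⊇⇒≡ G S-min (A-dominating q₀) A⊆S)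
  ... | inj₂ (r , _) , inj₁ B⊆S = inj₂ (inj₁ (MinDom-⊇⇒≡ G S-min (B-dominating r) B⊆S))
  ... | inj₂ (r , r∈S) , inj₂ (q , q∈S) =
    inj₂ (inj₂ (q , r , MinDom-⊇⇒≡ G S-min (pair-dominating q r) pair⊆S))
    where
    pair⊆S : pair q r ⊆ S
    pair⊆S x∈pair with ∈-pair⁻ x∈pair
    ... | inj₁ refl = q∈S
    ... | inj₂ refl = r∈S

  A⊆pair : ∀ {q r} → (∀ q' → q' ≡ q) → A ⊆ pair q r
  A⊆pair ≡q x∈A with IsA⇒↑ˡ (∈A⁻ x∈A)
  ... | q' , refl = subst (λ q → q ↑ˡ n ∈ pair _ _) (sym (≡q q')) ∈-pairˡ

  pair-¬MinDom : ∀ {q r} → (∀ q' → q' ≡ q) → ¬ MinDom G (pair q r)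
  pair-¬MinDom {q} {r} ≡q (_ , minimal) =
    minimal A (A⊆pair ≡q , m ↑ʳ r , ∈-pairʳ , IsB⇒∉A (IsB-↑ʳ r)) (A-dominating q)

  A→pair : ∀ {q r} → Step G A (pair q r) (m ↑ʳ r)
  A→pair {q} {r} = (λ x → mk⇔ (λ (x∈pair , x∉A) → ∈-pair-B (∉A⇒IsB x∉A) x∈pair) gained)
                 , (λ x x∈A _ → inj₂ (IsB-↑ʳ r , ∈A⁻ x∈A))
    where
    gained : ∀ {x} → x ≡ m ↑ʳ r → x ∈ pair q r × x ∉ A
    gained refl = ∈-pairʳ , IsB⇒∉A (IsB-↑ʳ r)

  B→pair : ∀ {q r} → Step G B (pair q r) (q ↑ˡ n)
  B→pair {q} {r} = (λ x → mk⇔ (λ (x∈pair , x∉B) → ∈-pair-A (∉B⇒IsA x∉B) x∈pair) gained)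
                 , (λ x x∈B _ → inj₁ (IsA-↑ˡ q , ∈B⁻ x∈B))
    where
    gained : ∀ {x} → x ≡ q ↑ˡ n → x ∈ pair q r × x ∉ B
    gained refl = ∈-pairˡ , IsA⇒∉B (IsA-↑ˡ q)

  B→A : ∀ {q} → (∀ q' → q' ≡ q) → Step G B A (q ↑ˡ n)
  B→A {q} ≡q = (λ x → mk⇔ (λ (x∈A , _) → lost (IsA⇒↑ˡ (∈A⁻ x∈A))) gained)
             , (λ x x∈B _ → inj₁ (IsA-↑ˡ q , ∈B⁻ x∈B))
    where
    lost : ∀ {x} → ∃ (λ q' → q' ↑ˡ n ≡ x) → x ≡ q ↑ˡ n
    lost (q' , refl) = cong (_↑ˡ n) (≡q q')
    gained : ∀ {x} → x ≡ q ↑ˡ n → x ∈ A × x ∉ B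
    gained refl = ∈A⁺ (IsA-↑ˡ q) , IsA⇒∉B (IsA-↑ˡ q)

  A≁B : 2 ≤ m → 2 ≤ n → ¬ RAdj G A B
  A≁B _ 2≤n (v , inj₁ step) with two-distinct 2≤n
  ... | (r₀ , r₁) , r₀≢r₁ = r₀≢r₁ (↑ʳ-injective m _ _ (trans (≡v r₀) (sym (≡v r₁))))
    where
    ≡v : ∀ r → m ↑ʳ r ≡ v
    ≡v r = Step-new⇒≡ G step (∈B⁺ (IsB-↑ʳ r)) (IsB⇒∉A (IsB-↑ʳ r))
  A≁B 2≤m _ (v , inj₂ step) with two-distinct 2≤m
  ... | (q₀ , q₁) , q₀≢q₁ = q₀≢q₁ (↑ˡ-injective n _ _ (trans (≡v q₀) (sym (≡v q₁))))
    where
    ≡v : ∀ q → q ↑ˡ n ≡ v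
    ≡v q = Step-new⇒≡ G step (∈A⁺ (IsA-↑ˡ q)) (IsA⇒∉B (IsA-↑ˡ q))

  pair↛pair : ∀ {q r q' r' v} → ¬ Step G (pair q r) (pair q' r') v
  pair↛pair {q} {r} {q'} {r'} step with Step-new G step
  ... | v∈new , v∉old with ∈-pair⁻ v∈new
  ... | inj₁ refl = Adj-A-A (IsA-↑ˡ q') (IsA-↑ˡ q) (proj₂ step _ ∈-pairˡ q∉new)
    where
    q∉new : q ↑ˡ n ∉ pair q' r'
    q∉new q∈new = v∉old (subst (λ q → q ↑ˡ n ∈ pair _ r) (↑ˡ∈pair⇒≡ q∈new) ∈-pairˡ)
  ... | inj₂ refl = Adj-B-B (IsB-↑ʳ r') (IsB-↑ʳ r) (proj₂ step _ ∈-pairʳ r∉new)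
    where
    r∉new : m ↑ʳ r ∉ pair q' r'
    r∉new r∈new = v∉old (subst (λ r → m ↑ʳ r ∈ pair q _) (↑ʳ∈pair⇒≡ r∈new) ∈-pairʳ)

  pair≁pair : ∀ {q r q' r'} → ¬ RAdj G (pair q r) (pair q' r')
  pair≁pair (_ , inj₁ step) = pair↛pair step
  pair≁pair (_ , inj₂ step) = pair↛pair step

  A≢B : Fin m → A ≢ B
  A≢B q A≡B = IsA⇒∉B (IsA-↑ˡ q) (subst (q ↑ˡ n ∈_) A≡B (∈A⁺ (IsA-↑ˡ q)))

  A≢pair : ∀ {q r} → A ≢ pair q r
  A≢pair {r = r} A≡pair = IsB⇒∉A (IsB-↑ʳ r) (subst (_ ∈_) (sym A≡pair) ∈-pairʳ)

  B≢pair : ∀ {q r} → B ≢ pair q r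
  B≢pair {q} B≡pair = IsA⇒∉B (IsA-↑ˡ q) (subst (_ ∈_) (sym B≡pair) ∈-pairˡ)

R[K₁,₁₊ₙ]≅K₂ : ∀ n → ReconfIso (KB 1 (suc n)) (K 2)
R[K₁,₁₊ₙ]≅K₂ n = sets , minimal , covering , injective , adjacency
  where
  open CompleteBipartite 1 (suc n)

  A-singleton : ∀ q → q ≡ 0F
  A-singleton 0F = refl

  sets : Fin 2 → Subset (1 + suc n)
  sets 0F = A
  sets 1F = B

  minimal : ∀ i → MinDom G (sets i)
  minimal 0F = A-MinDom 0F
  minimal 1F = B-MinDom 0F

  covering : ∀ S → MinDom G S → ∃ λ i → sets i ≡ S
  covering S S-min with MinDom-cases 0F S-min
  ... | inj₁ S≡A                    = 0F , sym S≡A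
  ... | inj₂ (inj₁ S≡B)             = 1F , sym S≡B
  ... | inj₂ (inj₂ (0F , r , refl)) = contradiction S-min (pair-¬MinDom {r = r} A-singleton)

  injective : ∀ i j → sets i ≡ sets j → i ≡ j
  injective 0F 0F _   = refl
  injective 0F 1F A≡B = contradiction A≡B (A≢B 0F)
  injective 1F 0F B≡A = contradiction (sym B≡A) (A≢B 0F)
  injective 1F 1F _   = refl

  adjacency : ∀ i j → Adj (K 2) i j ⇔ RAdj G (sets i) (sets j)
  adjacency 0F 0F = neither⇔ (irrefl (K 2) 0F) (RAdj-irrefl G)
  adjacency 0F 1F = both⇔ (λ ()) (_ , inj₂ (B→A A-singleton))
  adjacency 1F 0F = both⇔ (λ ()) (_ , inj₁ (B→A A-singleton))
  adjacency 1F 1F = neither⇔ (irrefl (K 2) 1F) (RAdj-irrefl G)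

R[Kₘ,ₙ]≅K₂,ₘₙ : ∀ m n → 2 ≤ m → 2 ≤ n → ReconfIso (KB m n) (KB 2 (m * n))
R[Kₘ,ₙ]≅K₂,ₘₙ m n 2≤m@(s≤s _) 2≤n@(s≤s _) = sets , minimal , covering , injective , adjacency
  where
  open CompleteBipartite m n
  module H = CompleteBipartite 2 (m * n)

  pairs : Fin (m * n) → Subset (m + n)
  pairs k = uncurry pair (remQuot n k)

  pairs-injective : ∀ {k k'} → pairs k ≡ pairs k' → k ≡ k'
  pairs-injective eq = Injection.injective (↔⇒↣ (*↔× {m} {n})) (×-≡,≡→≡ (pair-injective eq))

  sets : Fin (2 + m * n) → Subset (m + n)
  sets 0F = A
  sets 1F = B
  sets (Fin.suc (Fin.suc k)) = pairs k

  minimal : ∀ i → MinDom G (sets i)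
  minimal 0F = A-MinDom 0F
  minimal 1F = B-MinDom 0F
  minimal (Fin.suc (Fin.suc k)) = pair-MinDom 2≤m 2≤n _ _

  covering : ∀ S → MinDom G S → ∃ λ i → sets i ≡ S
  covering S S-min with MinDom-cases 0F S-min
  ... | inj₁ S≡A                 = 0F , sym S≡A
  ... | inj₂ (inj₁ S≡B)          = 1F , sym S≡B
  ... | inj₂ (inj₂ (q , r , refl)) =
    Fin.suc (Fin.suc (combine q r)) , cong (uncurry pair) (remQuot-combine q r)

  injective : ∀ i j → sets i ≡ sets j → i ≡ j
  injective 0F 0F _ = refl
  injective 0F 1F A≡B = contradiction A≡B (A≢B 0F)
  injective 0F (Fin.suc (Fin.suc _)) A≡pair = contradiction A≡pair A≢pair
  injective 1F 0F B≡A = contradiction (sym B≡A) (A≢B 0F)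
  injective 1F 1F _ = refl
  injective 1F (Fin.suc (Fin.suc _)) B≡pair = contradiction B≡pair B≢pair
  injective (Fin.suc (Fin.suc _)) 0F pair≡A = contradiction (sym pair≡A) A≢pair
  injective (Fin.suc (Fin.suc _)) 1F pair≡B = contradiction (sym pair≡B) B≢pair
  injective (Fin.suc (Fin.suc _)) (Fin.suc (Fin.suc _)) eq = cong (2 ↑ʳ_) (pairs-injective eq)

  -- The vertices 0F, 1F and suc (suc k) of K_{2,mn} are definitionally 0F ↑ˡ mn, 1F ↑ˡ mn, 2 ↑ʳ k.
  adjacency : ∀ i j → Adj (KB 2 (m * n)) i j ⇔ RAdj G (sets i) (sets j)
  adjacency 0F 0F = neither⇔ (irrefl H.G 0F) (RAdj-irrefl G)
  adjacency 0F 1F = neither⇔ (H.Adj-A-A (H.IsA-↑ˡ 0F) (H.IsA-↑ˡ 1F)) (A≁B 2≤m 2≤n)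
  adjacency 0F (Fin.suc (Fin.suc k)) = both⇔ (inj₁ (H.IsA-↑ˡ 0F , H.IsB-↑ʳ k)) (_ , inj₁ A→pair)
  adjacency 1F 0F =
    neither⇔ (H.Adj-A-A (H.IsA-↑ˡ 1F) (H.IsA-↑ˡ 0F)) (A≁B 2≤m 2≤n ∘ RAdj-sym G)
  adjacency 1F 1F = neither⇔ (irrefl H.G 1F) (RAdj-irrefl G)
  adjacency 1F (Fin.suc (Fin.suc k)) = both⇔ (inj₁ (H.IsA-↑ˡ 1F , H.IsB-↑ʳ k)) (_ , inj₁ B→pair)
  adjacency (Fin.suc (Fin.suc k)) 0F = both⇔ (inj₂ (H.IsB-↑ʳ k , H.IsA-↑ˡ 0F)) (_ , inj₂ A→pair)
  adjacency (Fin.suc (Fin.suc k)) 1F = both⇔ (inj₂ (H.IsB-↑ʳ k , H.IsA-↑ˡ 1F)) (_ , inj₂ B→pair)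
  adjacency (Fin.suc (Fin.suc k)) (Fin.suc (Fin.suc k')) =
    neither⇔ (H.Adj-B-B (H.IsB-↑ʳ k) (H.IsB-↑ʳ k')) pair≁pair

theorem5 : (∀ (n : ℕ) → ReconfIso (KB 1 (suc n)) (K 2))
    × (∀ (m n : ℕ) → 2 ≤ m → 2 ≤ n → ReconfIso (KB m n) (KB 2 (m * n)))
theorem5 = R[K₁,₁₊ₙ]≅K₂ , R[Kₘ,ₙ]≅K₂,ₘₙ
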